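{- Let $\Delta \ge 1$ be an integer. For every finite simple graph $G=(V,E)$ with maximum degree $\Delta$ and $n=|V|\ge 1$, \[ \alpha(G) \;\le\; \frac{(2\Delta+1)^2}{8\Delta}\,\mathrm{T}(G) \;=\; \Big(\frac{\Delta+1}{2} + \frac{1}{8\Delta}\Big)\mathrm{T}(G), \] where $\mathrm{T}(G) = \frac{n}{\bar d+1} = \frac{n^2}{2|E|+n}$. Moreover, this is tight: for every $\Delta \ge 1$ there is a graph $G$ of maximum degree $\Delta$ with $\alpha(G) = \frac{(2\Delta+1)^2}{8\Delta}\,\mathrm{T}(G)$.
   Context: $\alpha(G)$ denotes the maximum cardinality of an independent set in $G$; $\bar d = 2|E|/n$ is the average degree; $\mathrm{T}(G)=n/(\bar d+1)$ is the Turán bound (which satisfies $\alpha(G)\ge \mathrm{T}(G)$). -}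

module Defs where

open import Data.Nat using (ℕ; _+_; _*_; _≤_; _<_)
open import Data.Nat.ListAction using (sum)
open import Data.Bool using (Bool; true; false; _∧_; if_then_else_)
open import Data.Fin using (Fin; toℕ; _<?_)
open import Data.Fin.Subset using (Subset; _∈_; ∣_∣)
open import Data.Vec using (tabulate)
open import Data.List using (map)
open import Data.List using () renaming (tabulate to ltabulate)
open import Data.Product using (Σ; _×_; ∃)
open import Relation.Binary.PropositionalEquality using (_≡_)
open import Relation.Nullary using (¬_)
open import Relation.Nullary.Decidable using (⌊_⌋)

record Graph (n : ℕ) : Set where
  field
    adj     : Fin n → Fin n → Bool
    symm    : ∀ i j → adj i j ≡ adj j i
    irrefl  : ∀ i → adj i i ≡ false
open Graph public

nbhd : ∀ {n} → Graph n → Fin n → Subset n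
nbhd G i = tabulate (adj G i)

degree : ∀ {n} → Graph n → Fin n → ℕ
degree G i = ∣ nbhd G i ∣

HasMaxDegree : ∀ {n} → Graph n → ℕ → Set
HasMaxDegree G Δ = (∀ i → degree G i ≤ Δ) × ∃ (λ i → degree G i ≡ Δ)

edgesAt : ∀ {n} → Graph n → Fin n → ℕ
edgesAt G i = ∣ tabulate (λ j → ⌊ i <? j ⌋ ∧ adj G i j) ∣

numEdges : ∀ {n} → Graph n → ℕ
numEdges {n} G = sum (ltabulate (edgesAt G))

Independent : ∀ {n} → Graph n → Subset n → Set
Independent G S = ∀ i j → i ∈ S → j ∈ S → adj G i j ≡ false

IsIndependenceNumber : ∀ {n} → Graph n → ℕ → Set
IsIndependenceNumber G k =
  (∃ λ S → Independent G S × ∣ S ∣ ≡ k) ×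
  (∀ S → Independent G S → ∣ S ∣ ≤ k)

-- Every edge has an endpoint outside an independent set S, so |E| ≤ Δ (n − |S|).
-- With A = 4Δ|S| and B = (2Δ+1) n this gives 8Δ|S| (2|E| + n) ≤ 2AB − A² ≤ B²,
-- i.e. the bound, with equality iff every vertex outside S has degree Δ, no edge
-- lies outside S, and A = B.  Equality is attained by a bipartite graph with
-- Δ(2Δ−1) "low" vertices of degree Δ, each joined to a window of Δ consecutive
-- vertices among Δ(2Δ+1) "high" ones.
module Submission where

open import Defs
open import Data.Bool using (Bool; true; false; _∧_)
open import Data.Bool.Properties using (∧-zeroʳ)
open import Data.Empty using (⊥-elim)
open import Data.Fin as Fin using (Fin; toℕ; fromℕ<)
open import Data.Fin.Properties using (toℕ<n; toℕ-injective; toℕ-fromℕ<)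
open import Data.Fin.Subset using (Subset; _∈_; _∉_; ∣_∣; ∁)
open import Data.Fin.Subset.Properties using (x∉∁p⇒x∈p; ∣∁p∣≡n∸∣p∣; ∣p∣≤n)
open import Data.List.Base using ([]; _∷_) renaming (tabulate to listTabulate)
open import Data.Nat.Base
  using (ℕ; zero; suc; _+_; _*_; _∸_; _^_; _≤_; _<_; z≤n; s≤s)
import Data.Nat.ListAction as List
open import Data.Nat.Properties
open import Data.Nat.Tactic.RingSolver using (solve; solve-∀)
open import Data.Product using (Σ; _×_; _,_; proj₁; proj₂)
open import Data.Sum using (_⊎_; inj₁; inj₂; [_,_]′; swap)
open import Data.Vec using (tabulate; lookup)
open import Data.Vec.Properties using (tabulate∘lookup; lookup∘tabulate; []=⇒lookup)
open import Function using (_∘_; mk⇔)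
open import Relation.Binary.PropositionalEquality
  using (_≡_; refl; sym; trans; cong; cong₂; subst; subst₂; module ≡-Reasoning)
open import Relation.Nullary using (Dec; yes; no; does; ¬_)
open import Relation.Nullary.Decidable
  using (⌊_⌋; _×-dec_; _⊎-dec_; dec-true; dec-false; does-⇔; isYes≗does)
open import Relation.Unary using (Decidable)

open import Algebra.Properties.Semiring.Sum +-*-semiring
  using (sum; sum-syntax; sum-cong-≗; ∑-distrib-+; ∑-comm; *-distribˡ-sum; *-distribʳ-sum)

indicator : Bool → ℕ
indicator true  = 1
indicator false = 0

indicator≤1 : ∀ b → indicator b ≤ 1
indicator≤1 true  = s≤s z≤n
indicator≤1 false = z≤n

square-*-square : ∀ x y → x * x * (y * y) ≡ x ^ 2 * y ^ 2
square-*-square x y = sym (cong₂ _*_ (cong (x *_) (*-identityʳ x)) (cong (y *_) (*-identityʳ y)))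

2mn≤m²+n² : ∀ m n → 2 * m * n ≤ m * m + n * n
2mn≤m²+n² m n =
  [ ordered , (λ n≤m → subst₂ _≤_ swapped (+-comm (n * n) (m * m)) (ordered n≤m)) ]′
  (≤-total m n)
  where
  swapped : 2 * n * m ≡ 2 * m * n
  swapped = solve (m ∷ n ∷ [])
  ordered : ∀ {a b} → a ≤ b → 2 * a * b ≤ a * a + b * b
  ordered {a} a≤b with m≤n⇒∃[o]m+o≡n a≤b
  ... | d , refl = subst (2 * a * (a + d) ≤_) expand (m≤m+n _ (d * d))
    where
    expand : 2 * a * (a + d) + d * d ≡ a * a + (a + d) * (a + d)
    expand = solve (a ∷ d ∷ [])

ratio-bound : ∀ {Δ m n a} → m + Δ * a ≤ Δ * n →
  a * (8 * Δ) * (2 * m + n) ≤ (2 * Δ + 1) ^ 2 * n ^ 2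
ratio-bound {Δ} {m} {n} {a} h = +-cancelʳ-≤ (4 * Δ * a * (4 * Δ * a)) _ _ (begin
  a * (8 * Δ) * (2 * m + n) + 4 * Δ * a * (4 * Δ * a)
    ≡⟨ solve (Δ ∷ m ∷ n ∷ a ∷ []) ⟩
  16 * Δ * a * (m + Δ * a) + 8 * Δ * a * n
    ≤⟨ +-monoˡ-≤ _ (*-monoʳ-≤ (16 * Δ * a) h) ⟩
  16 * Δ * a * (Δ * n) + 8 * Δ * a * n
    ≡⟨ solve (Δ ∷ n ∷ a ∷ []) ⟩
  2 * (4 * Δ * a) * ((2 * Δ + 1) * n)
    ≤⟨ 2mn≤m²+n² (4 * Δ * a) ((2 * Δ + 1) * n) ⟩
  4 * Δ * a * (4 * Δ * a) + (2 * Δ + 1) * n * ((2 * Δ + 1) * n)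
    ≡⟨ solve (Δ ∷ n ∷ a ∷ []) ⟩
  (2 * Δ + 1) * (2 * Δ + 1) * (n * n) + 4 * Δ * a * (4 * Δ * a)
    ≡⟨ cong (_+ 4 * Δ * a * (4 * Δ * a)) (square-*-square (2 * Δ + 1) n) ⟩
  (2 * Δ + 1) ^ 2 * n ^ 2 + 4 * Δ * a * (4 * Δ * a) ∎)
  where open ≤-Reasoning

∑-mono-≤ : ∀ {n} {f g : Fin n → ℕ} → (∀ i → f i ≤ g i) → sum f ≤ sum g
∑-mono-≤ {zero}  _   = z≤n
∑-mono-≤ {suc n} f≤g = +-mono-≤ (f≤g Fin.zero) (∑-mono-≤ (f≤g ∘ Fin.suc))

∑-const : ∀ n c → ∑[ i < n ] c ≡ n * c
∑-const zero    c = refl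
∑-const (suc n) c = cong (c +_) (∑-const n c)

∣tabulate∣≡∑ : ∀ {n} (f : Fin n → Bool) → ∣ tabulate f ∣ ≡ ∑[ i < n ] indicator (f i)
∣tabulate∣≡∑ {zero}  f = refl
∣tabulate∣≡∑ {suc n} f with f Fin.zero
... | true  = cong suc (∣tabulate∣≡∑ (f ∘ Fin.suc))
... | false = ∣tabulate∣≡∑ (f ∘ Fin.suc)

∣p∣≡∑ : ∀ {n} (p : Subset n) → ∣ p ∣ ≡ ∑[ i < n ] indicator (lookup p i)
∣p∣≡∑ p = trans (cong ∣_∣ (sym (tabulate∘lookup p))) (∣tabulate∣≡∑ (lookup p))

sum-listTabulate : ∀ {n} (f : Fin n → ℕ) → List.sum (listTabulate f) ≡ sum f
sum-listTabulate {zero}  f = refl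
sum-listTabulate {suc n} f = cong (f Fin.zero +_) (sum-listTabulate (f ∘ Fin.suc))

∑∑-symmetrise : ∀ {n} (w : Fin n → ℕ) (x : Fin n → Fin n → ℕ) →
  ∑[ i < n ] ∑[ j < n ] ((w i + w j) * x i j) ≡ ∑[ i < n ] (w i * ∑[ j < n ] (x i j + x j i))
∑∑-symmetrise {n} w x = begin
  ∑[ i < n ] ∑[ j < n ] ((w i + w j) * x i j)
    ≡⟨ sum-cong-≗ (λ i → trans (sum-cong-≗ (λ j → *-distribʳ-+ (x i j) (w i) (w j)))
                                (∑-distrib-+ (λ j → w i * x i j) (λ j → w j * x i j))) ⟩
  ∑[ i < n ] (∑[ j < n ] (w i * x i j) + ∑[ j < n ] (w j * x i j))
    ≡⟨ ∑-distrib-+ (λ i → ∑[ j < n ] (w i * x i j)) (λ i → ∑[ j < n ] (w j * x i j)) ⟩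
  ∑[ i < n ] ∑[ j < n ] (w i * x i j) + ∑[ i < n ] ∑[ j < n ] (w j * x i j)
    ≡⟨ cong (∑[ i < n ] ∑[ j < n ] (w i * x i j) +_) (∑-comm (λ i j → w j * x i j)) ⟩
  ∑[ i < n ] ∑[ j < n ] (w i * x i j) + ∑[ i < n ] ∑[ j < n ] (w i * x j i)
    ≡⟨ sym (∑-distrib-+ (λ i → ∑[ j < n ] (w i * x i j)) (λ i → ∑[ j < n ] (w i * x j i))) ⟩
  ∑[ i < n ] (∑[ j < n ] (w i * x i j) + ∑[ j < n ] (w i * x j i))
    ≡⟨ sum-cong-≗ (λ i → sym (pull-out i)) ⟩
  ∑[ i < n ] (w i * ∑[ j < n ] (x i j + x j i)) ∎
  where
  open ≡-Reasoning
  pull-out : ∀ i →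
    w i * ∑[ j < n ] (x i j + x j i) ≡ ∑[ j < n ] (w i * x i j) + ∑[ j < n ] (w i * x j i)
  pull-out i = begin
    w i * ∑[ j < n ] (x i j + x j i)            ≡⟨ *-distribˡ-sum (w i) (λ j → x i j + x j i) ⟩
    ∑[ j < n ] (w i * (x i j + x j i))          ≡⟨ sum-cong-≗ (λ j → *-distribˡ-+ (w i) (x i j) (x j i)) ⟩
    ∑[ j < n ] (w i * x i j + w i * x j i)      ≡⟨ ∑-distrib-+ (λ j → w i * x i j) (λ j → w i * x j i) ⟩
    ∑[ j < n ] (w i * x i j) + ∑[ j < n ] (w i * x j i) ∎

does≡true⇒ : ∀ {A : Set} (a? : Dec A) → does a? ≡ true → A
does≡true⇒ (yes a) _ = a

lookup≡false⇒∉ : ∀ {n} {p : Subset n} {i} → lookup p i ≡ false → i ∉ p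
lookup≡false⇒∉ {i = i} p[i]≡false i∈p with trans (sym ([]=⇒lookup i∈p)) p[i]≡false
... | ()

module _ {n} (G : Graph n) where

  forwardEdge : Fin n → Fin n → ℕ
  forwardEdge i j = indicator (⌊ i Fin.<? j ⌋ ∧ adj G i j)

  numEdges≡∑∑forwardEdge : numEdges G ≡ ∑[ i < n ] ∑[ j < n ] forwardEdge i j
  numEdges≡∑∑forwardEdge =
    trans (sum-listTabulate (edgesAt G))
          (sum-cong-≗ (λ i → ∣tabulate∣≡∑ (λ j → ⌊ i Fin.<? j ⌋ ∧ adj G i j)))

  indicator-adj≡forward+backward : ∀ i j → indicator (adj G i j) ≡ forwardEdge i j + forwardEdge j i
  indicator-adj≡forward+backward i j with i Fin.<? j | j Fin.<? i
  ... | yes i<j | yes j<i = ⊥-elim (<-asym i<j j<i)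
  ... | yes _   | no _    = sym (+-identityʳ _)
  ... | no _    | yes _   = cong indicator (symm G i j)
  ... | no i≮j  | no j≮i rewrite toℕ-injective (≤-antisym (≮⇒≥ j≮i) (≮⇒≥ i≮j)) =
    cong indicator (irrefl G j)

  degree≡∑forwardEdge : ∀ i → degree G i ≡ ∑[ j < n ] (forwardEdge i j + forwardEdge j i)
  degree≡∑forwardEdge i =
    trans (∣tabulate∣≡∑ (adj G i)) (sum-cong-≗ (indicator-adj≡forward+backward i))

  module _ {S : Subset n} (S-independent : Independent G S) where

    notInS : Fin n → ℕ
    notInS i = indicator (lookup (∁ S) i)

    forwardEdge-covered : ∀ i j →
      forwardEdge i j ≤ (indicator (lookup (∁ S) i) + indicator (lookup (∁ S) j)) * forwardEdge i j
    forwardEdge-covered i j with lookup (∁ S) i in i∉S | lookup (∁ S) j in j∉S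
    ... | true  | _     = m≤m+n _ _
    ... | false | true  = ≤-reflexive (sym (+-identityʳ _))
    ... | false | false = ≤-reflexive (begin
      indicator (⌊ i Fin.<? j ⌋ ∧ adj G i j) ≡⟨ cong (λ b → indicator (⌊ i Fin.<? j ⌋ ∧ b)) i≁j ⟩
      indicator (⌊ i Fin.<? j ⌋ ∧ false)     ≡⟨ cong indicator (∧-zeroʳ _) ⟩
      0                                      ∎)
      where
      open ≡-Reasoning
      i≁j : adj G i j ≡ false
      i≁j = S-independent i j (x∉∁p⇒x∈p (lookup≡false⇒∉ i∉S)) (x∉∁p⇒x∈p (lookup≡false⇒∉ j∉S))

    numEdges≤∑∁degree : numEdges G ≤ ∑[ i < n ] (notInS i * degree G i)
    numEdges≤∑∁degree = begin
      numEdges G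
        ≡⟨ numEdges≡∑∑forwardEdge ⟩
      ∑[ i < n ] ∑[ j < n ] forwardEdge i j
        ≤⟨ ∑-mono-≤ (λ i → ∑-mono-≤ (forwardEdge-covered i)) ⟩
      ∑[ i < n ] ∑[ j < n ] ((notInS i + notInS j) * forwardEdge i j)
        ≡⟨ ∑∑-symmetrise notInS forwardEdge ⟩
      ∑[ i < n ] (notInS i * ∑[ j < n ] (forwardEdge i j + forwardEdge j i))
        ≡⟨ sum-cong-≗ (λ i → cong (notInS i *_) (sym (degree≡∑forwardEdge i))) ⟩
      ∑[ i < n ] (notInS i * degree G i) ∎
      where open ≤-Reasoning

    numEdges+Δ∣S∣≤Δn : ∀ {Δ} → (∀ i → degree G i ≤ Δ) → numEdges G + Δ * ∣ S ∣ ≤ Δ * n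
    numEdges+Δ∣S∣≤Δn {Δ} degree≤Δ = begin
      numEdges G + Δ * ∣ S ∣
        ≤⟨ +-monoˡ-≤ _ numEdges≤∑∁degree ⟩
      ∑[ i < n ] (notInS i * degree G i) + Δ * ∣ S ∣
        ≤⟨ +-monoˡ-≤ _ (∑-mono-≤ (λ i → *-monoʳ-≤ (notInS i) (degree≤Δ i))) ⟩
      ∑[ i < n ] (notInS i * Δ) + Δ * ∣ S ∣
        ≡⟨ cong (_+ Δ * ∣ S ∣) (sym (*-distribʳ-sum Δ notInS)) ⟩
      (∑[ i < n ] notInS i) * Δ + Δ * ∣ S ∣
        ≡⟨ cong (λ c → c * Δ + Δ * ∣ S ∣) (trans (sym (∣p∣≡∑ (∁ S))) (∣∁p∣≡n∸∣p∣ S)) ⟩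
      (n ∸ ∣ S ∣) * Δ + Δ * ∣ S ∣
        ≡⟨ cong (_+ Δ * ∣ S ∣) (*-comm (n ∸ ∣ S ∣) Δ) ⟩
      Δ * (n ∸ ∣ S ∣) + Δ * ∣ S ∣
        ≡⟨ sym (*-distribˡ-+ Δ (n ∸ ∣ S ∣) ∣ S ∣) ⟩
      Δ * (n ∸ ∣ S ∣ + ∣ S ∣)
        ≡⟨ cong (Δ *_) (m∸n+n≡m (∣p∣≤n S)) ⟩
      Δ * n ∎
      where open ≤-Reasoning

  independenceNumber-ratio-bound : ∀ {Δ α} → (∀ i → degree G i ≤ Δ) → IsIndependenceNumber G α →
    α * (8 * Δ) * (2 * numEdges G + n) ≤ (2 * Δ + 1) ^ 2 * n ^ 2
  independenceNumber-ratio-bound {Δ} degree≤Δ ((S , S-independent , refl) , _) =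
    ratio-bound {Δ} {numEdges G} {n} {∣ S ∣} (numEdges+Δ∣S∣≤Δn S-independent degree≤Δ)

∑-toℕ-+ : ∀ m n (f : ℕ → ℕ) →
  ∑[ i < m + n ] f (toℕ i) ≡ ∑[ i < m ] f (toℕ i) + ∑[ i < n ] f (m + toℕ i)
∑-toℕ-+ zero    n f = refl
∑-toℕ-+ (suc m) n f = trans (cong (f 0 +_) (∑-toℕ-+ m n (f ∘ suc))) (sym (+-assoc (f 0) _ _))

∑-toℕ-cong : ∀ n {f g : ℕ → ℕ} → (∀ v → v < n → f v ≡ g v) →
  ∑[ i < n ] f (toℕ i) ≡ ∑[ i < n ] g (toℕ i)
∑-toℕ-cong n f≡g = sum-cong-≗ (λ i → f≡g (toℕ i) (toℕ<n i))

count : ℕ → {P : ℕ → Set} → Decidable P → ℕ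
count n P? = ∑[ i < n ] indicator (does (P? (toℕ i)))

private variable
  P : ℕ → Set

count-+ : ∀ m n (P? : Decidable P) → count (m + n) P? ≡ count m P? + count n (λ v → P? (m + v))
count-+ m n P? = ∑-toℕ-+ m n (λ v → indicator (does (P? v)))

count-mono : ∀ {m n} (P? : Decidable P) → m ≤ n → count m P? ≤ count n P?
count-mono {m = m} P? m≤n with m≤n⇒∃[o]m+o≡n m≤n
... | o , refl = subst (count m P? ≤_) (sym (count-+ m o P?)) (m≤m+n _ _)

count≤n : ∀ n (P? : Decidable P) → count n P? ≤ n
count≤n n P? = ≤-trans (∑-mono-≤ {n} {g = λ _ → 1} (λ i → indicator≤1 (does (P? (toℕ i)))))
                       (≤-reflexive (trans (∑-const n 1) (*-identityʳ n)))

count-none : ∀ n (P? : Decidable P) → (∀ v → v < n → ¬ P v) → count n P? ≡ 0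
count-none n P? ¬P = trans (∑-toℕ-cong n (λ v v<n → cong indicator (dec-false (P? v) (¬P v v<n))))
                           (trans (∑-const n 0) (*-zeroʳ n))

count-all : ∀ n (P? : Decidable P) → (∀ v → v < n → P v) → count n P? ≡ n
count-all n P? allP = trans (∑-toℕ-cong n (λ v v<n → cong indicator (dec-true (P? v) (allP v v<n))))
                            (trans (∑-const n 1) (*-identityʳ n))

module _ {P : ℕ → Set} {a D} (P? : Decidable P) (P⇒window : ∀ v → P v → a ≤ v × v < a + D) where

  count-window-restrict : ∀ r → count (a + D + r) P? ≡ count D (λ v → P? (a + v))
  count-window-restrict r = begin
    count (a + D + r) P?
      ≡⟨ count-+ (a + D) r P? ⟩
    count (a + D) P? + count r (λ v → P? (a + D + v))
      ≡⟨ cong₂ _+_ (count-+ a D P?)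
                   (count-none r (λ v → P? (a + D + v))
                               (λ v _ p → <⇒≱ (proj₂ (P⇒window _ p)) (m≤m+n (a + D) v))) ⟩
    count a P? + count D (λ v → P? (a + v)) + 0
      ≡⟨ cong (λ c → c + count D (λ v → P? (a + v)) + 0)
              (count-none a P? (λ v v<a p → <⇒≱ v<a (proj₁ (P⇒window v p)))) ⟩
    count D (λ v → P? (a + v)) + 0
      ≡⟨ +-identityʳ _ ⟩
    count D (λ v → P? (a + v)) ∎
    where open ≡-Reasoning

  count≤window : ∀ n → count n P? ≤ D
  count≤window n = begin
    count n P?                  ≤⟨ count-mono P? (m≤n+m n (a + D)) ⟩
    count (a + D + n) P?        ≡⟨ count-window-restrict n ⟩
    count D (λ v → P? (a + v))  ≤⟨ count≤n D (λ v → P? (a + v)) ⟩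
    D                           ∎
    where open ≤-Reasoning

  count≡window : ∀ {n} → a + D ≤ n → (∀ v → a ≤ v → v < a + D → P v) → count n P? ≡ D
  count≡window a+D≤n window⇒P with m≤n⇒∃[o]m+o≡n a+D≤n
  ... | r , refl = trans (count-window-restrict r)
                         (count-all D (λ v → P? (a + v))
                                    (λ v v<D → window⇒P (a + v) (m≤m+n a v) (+-monoʳ-< a v<D)))

module TightExample (k : ℕ) where

  Δ L H n : ℕ
  Δ = suc k
  L = Δ * (2 * k + 1)
  H = Δ * (2 * k + 3)
  n = L + H

  H≡L+Δ+Δ : H ≡ L + Δ + Δ
  H≡L+Δ+Δ = identity k
    where
    -- Δ, L and H are unfolded because the solver treats defined names as atoms.
    identity : ∀ k → suc k * (2 * k + 3) ≡ suc k * (2 * k + 1) + suc k + suc k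
    identity = solve-∀

  0<L : 0 < L
  0<L = ≤-trans (m≤n+m 1 (2 * k)) (m≤n*m (2 * k + 1) Δ)

  Spoke : ℕ → ℕ → Set
  Spoke u v = u < L × L + u ≤ v × v < L + u + Δ

  spoke? : ∀ u v → Dec (Spoke u v)
  spoke? u v = u <? L ×-dec L + u ≤? v ×-dec v <? L + u + Δ

  Adjacent : ℕ → ℕ → Set
  Adjacent u v = Spoke u v ⊎ Spoke v u

  adjacent? : ∀ u v → Dec (Adjacent u v)
  adjacent? u v = spoke? u v ⊎-dec spoke? v u

  spoke-high : ∀ {u v} → Spoke u v → L ≤ v
  spoke-high (_ , L+u≤v , _) = ≤-trans (m≤m+n L _) L+u≤v

  spoke-< : ∀ {u v} → Spoke u v → u < v
  spoke-< s@(u<L , _) = <-≤-trans u<L (spoke-high s)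

  adjacent-low : ∀ {u v} → u < L → Adjacent u v → Spoke u v
  adjacent-low _   (inj₁ s) = s
  adjacent-low u<L (inj₂ s) = ⊥-elim (<⇒≱ u<L (spoke-high s))

  adjacent-high : ∀ {u v} → L ≤ u → Adjacent u v → Spoke v u
  adjacent-high L≤u (inj₁ (u<L , _)) = ⊥-elim (<⇒≱ u<L L≤u)
  adjacent-high _   (inj₂ s)         = s

  G : Graph n
  G = record
    { adj    = λ i j → does (adjacent? (toℕ i) (toℕ j))
    ; symm   = λ i j → does-⇔ (mk⇔ swap swap) (adjacent? (toℕ i) (toℕ j)) (adjacent? (toℕ j) (toℕ i))
    ; irrefl = λ i → dec-false (adjacent? (toℕ i) (toℕ i)) [ no-loop , no-loop ]′
    }
    where
    no-loop : ∀ {u} → ¬ Spoke u u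
    no-loop s = <-irrefl refl (spoke-< s)

  degree≡count : ∀ i → degree G i ≡ count n (adjacent? (toℕ i))
  degree≡count i = ∣tabulate∣≡∑ (adj G i)

  low-window-fits : ∀ {u} → u < L → L + u + Δ ≤ n
  low-window-fits {u} u<L = begin
    L + u + Δ       ≤⟨ +-monoˡ-≤ Δ (+-monoʳ-≤ L (<⇒≤ u<L)) ⟩
    L + L + Δ       ≡⟨ +-assoc L L Δ ⟩
    L + (L + Δ)     ≤⟨ +-monoʳ-≤ L (m≤m+n (L + Δ) Δ) ⟩
    L + (L + Δ + Δ) ≡⟨ cong (L +_) (sym H≡L+Δ+Δ) ⟩
    n               ∎
    where open ≤-Reasoning

  neighbours-low : ∀ {u} → u < L → count n (adjacent? u) ≡ Δ
  neighbours-low u<L = count≡window (adjacent? _) (λ v → proj₂ ∘ adjacent-low u<L) (low-window-fits u<L)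
                                (λ v L+u≤v v<L+u+Δ → inj₁ (u<L , L+u≤v , v<L+u+Δ))

  neighbours-high : ∀ x → count n (adjacent? (L + x)) ≤ Δ
  neighbours-high x = count≤window {a = suc x ∸ Δ} (adjacent? (L + x)) high-window n
    where
    high-window : ∀ v → Adjacent (L + x) v → suc x ∸ Δ ≤ v × v < suc x ∸ Δ + Δ
    high-window v a with adjacent-high (m≤m+n L x) a
    ... | _ , L+v≤L+x , L+x<L+v+Δ =
        m≤n+o⇒m∸n≤o (suc x) Δ (subst (suc x ≤_) (+-comm v Δ) x<v+Δ)
      , <-≤-trans (s≤s (+-cancelˡ-≤ L v x L+v≤L+x)) (subst (suc x ≤_) (+-comm Δ _) (m≤n+m∸n (suc x) Δ))
      where
      x<v+Δ : x < v + Δ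
      x<v+Δ = +-cancelˡ-< L x (v + Δ) (subst (L + x <_) (+-assoc L v Δ) L+x<L+v+Δ)

  neighbours≤Δ : ∀ u → count n (adjacent? u) ≤ Δ
  neighbours≤Δ u with L ≤? u
  ... | yes L≤u = subst (λ w → count n (adjacent? w) ≤ Δ) (m+[n∸m]≡n L≤u) (neighbours-high (u ∸ L))
  ... | no  u≱L = ≤-reflexive (neighbours-low (≰⇒> u≱L))

  degree≤Δ : ∀ i → degree G i ≤ Δ
  degree≤Δ i = subst (_≤ Δ) (sym (degree≡count i)) (neighbours≤Δ (toℕ i))

  hasMaxDegree : HasMaxDegree G Δ
  hasMaxDegree = degree≤Δ , vertex0 , trans (degree≡count vertex0)
                   (subst (λ u → count n (adjacent? u) ≡ Δ) (sym (toℕ-fromℕ< 0<n)) (neighbours-low 0<L))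
    where
    0<n : 0 < n
    0<n = ≤-trans 0<L (m≤m+n L H)
    vertex0 : Fin n
    vertex0 = fromℕ< 0<n

  Upward : ℕ → ℕ → Set
  Upward u v = u < v × Adjacent u v

  upward? : ∀ u v → Dec (Upward u v)
  upward? u v = u <? v ×-dec adjacent? u v

  -- Defs counts with ⌊_⌋ (isYes), which is not definitionally does on an open decision.
  edgesAt≡count : ∀ i → edgesAt G i ≡ count n (upward? (toℕ i))
  edgesAt≡count i = trans (∣tabulate∣≡∑ {n} (λ j → ⌊ i Fin.<? j ⌋ ∧ adj G i j)) (sum-cong-≗ {n} (λ j →
    cong (λ b → indicator (b ∧ does (adjacent? (toℕ i) (toℕ j)))) (isYes≗does (toℕ i <? toℕ j))))

  upward-low : ∀ {u} → u < L → count n (upward? u) ≡ Δ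
  upward-low u<L = count≡window (upward? _) (λ v → proj₂ ∘ adjacent-low u<L ∘ proj₂) (low-window-fits u<L)
                               (λ v L+u≤v v<L+u+Δ → let s = u<L , L+u≤v , v<L+u+Δ in spoke-< s , inj₁ s)

  upward-high : ∀ {u} → L ≤ u → count n (upward? u) ≡ 0
  upward-high L≤u = count-none n (upward? _) (λ v _ (u<v , a) →
    <-asym u<v (<-≤-trans (proj₁ (adjacent-high L≤u a)) L≤u))

  numEdges≡LΔ : numEdges G ≡ L * Δ
  numEdges≡LΔ = begin
    numEdges G                              ≡⟨ sum-listTabulate (edgesAt G) ⟩
    ∑[ i < n ] edgesAt G i                  ≡⟨ sum-cong-≗ edgesAt≡count ⟩
    ∑[ i < n ] count n (upward? (toℕ i))    ≡⟨ ∑-toℕ-+ L H (λ u → count n (upward? u)) ⟩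
    ∑[ i < L ] count n (upward? (toℕ i)) + ∑[ i < H ] count n (upward? (L + toℕ i))
      ≡⟨ cong₂ _+_ (∑-toℕ-cong L {g = λ _ → Δ} (λ _ → upward-low))
                   (∑-toℕ-cong H {g = λ _ → 0} (λ x _ → upward-high (m≤m+n L x))) ⟩
    ∑[ i < L ] Δ + ∑[ i < H ] 0             ≡⟨ cong₂ _+_ (∑-const L Δ) (trans (∑-const H 0) (*-zeroʳ H)) ⟩
    L * Δ + 0                               ≡⟨ +-identityʳ _ ⟩
    L * Δ                                   ∎
    where open ≡-Reasoning

  highSet : Subset n
  highSet = tabulate (λ i → does (L ≤? toℕ i))

  ∈highSet⇒high : ∀ {i} → i ∈ highSet → L ≤ toℕ i
  ∈highSet⇒high {i} i∈highSet =
    does≡true⇒ (L ≤? toℕ i)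
      (trans (sym (lookup∘tabulate (λ j → does (L ≤? toℕ j)) i)) ([]=⇒lookup i∈highSet))

  highSet-independent : Independent G highSet
  highSet-independent i j i∈highSet j∈highSet = dec-false (adjacent? (toℕ i) (toℕ j))
    [ (λ (i<L , _) → <⇒≱ i<L (∈highSet⇒high i∈highSet))
    , (λ (j<L , _) → <⇒≱ j<L (∈highSet⇒high j∈highSet))
    ]′

  ∣highSet∣≡H : ∣ highSet ∣ ≡ H
  ∣highSet∣≡H = begin
    ∣ highSet ∣                                     ≡⟨ ∣tabulate∣≡∑ {n} (λ i → does (L ≤? toℕ i)) ⟩
    count (L + H) (L ≤?_)                           ≡⟨ count-+ L H (L ≤?_) ⟩
    count L (L ≤?_) + count H (λ v → L ≤? L + v)    ≡⟨ cong₂ _+_ (count-none L (L ≤?_) (λ _ v<L → <⇒≱ v<L))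
                                                                 (count-all H (λ v → L ≤? L + v) (λ v _ → m≤m+n L v)) ⟩
    H                                               ∎
    where open ≡-Reasoning

  independenceNumber : IsIndependenceNumber G H
  independenceNumber = (highSet , highSet-independent , ∣highSet∣≡H) , maximal
    where
    maximal : ∀ S → Independent G S → ∣ S ∣ ≤ H
    maximal S S-independent = *-cancelˡ-≤ Δ (+-cancelˡ-≤ (L * Δ) _ _ (begin
      L * Δ + Δ * ∣ S ∣       ≡⟨ cong (_+ Δ * ∣ S ∣) (sym numEdges≡LΔ) ⟩
      numEdges G + Δ * ∣ S ∣  ≤⟨ numEdges+Δ∣S∣≤Δn G S-independent degree≤Δ ⟩
      Δ * (L + H)             ≡⟨ *-distribˡ-+ Δ L H ⟩
      Δ * L + Δ * H           ≡⟨ cong (_+ Δ * H) (*-comm Δ L) ⟩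
      L * Δ + Δ * H           ∎))
      where open ≤-Reasoning

  extremal : H * (8 * Δ) * (2 * numEdges G + n) ≡ (2 * Δ + 1) ^ 2 * n ^ 2
  extremal = begin
    H * (8 * Δ) * (2 * numEdges G + n)   ≡⟨ cong (λ m → H * (8 * Δ) * (2 * m + n)) numEdges≡LΔ ⟩
    H * (8 * Δ) * (2 * (L * Δ) + n)      ≡⟨ identity k ⟩
    (2 * Δ + 1) * (2 * Δ + 1) * (n * n)  ≡⟨ square-*-square (2 * Δ + 1) n ⟩
    (2 * Δ + 1) ^ 2 * n ^ 2              ∎
    where
    open ≡-Reasoning
    identity : ∀ k → let Δ = suc k; L = Δ * (2 * k + 1); H = Δ * (2 * k + 3); n = L + H in
      H * (8 * Δ) * (2 * (L * Δ) + n) ≡ (2 * Δ + 1) * (2 * Δ + 1) * (n * n)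
    identity = solve-∀

  tight : Σ ℕ λ n → Σ (Graph n) λ G → HasMaxDegree G Δ × Σ ℕ λ α →
    IsIndependenceNumber G α × α * (8 * Δ) * (2 * numEdges G + n) ≡ (2 * Δ + 1) ^ 2 * n ^ 2
  tight = n , G , hasMaxDegree , H , independenceNumber , extremal

mainTheorem3 : (Δ : ℕ) → 1 ≤ Δ →
    ((n : ℕ) → 1 ≤ n → (G : Graph n) → HasMaxDegree G Δ →
      (α : ℕ) → IsIndependenceNumber G α →
      α * (8 * Δ) * (2 * numEdges G + n) ≤ (2 * Δ + 1) ^ 2 * n ^ 2)
    × (Σ ℕ λ n → Σ (Graph n) λ G → HasMaxDegree G Δ × Σ ℕ λ α →
        IsIndependenceNumber G α ×
        α * (8 * Δ) * (2 * numEdges G + n) ≡ (2 * Δ + 1) ^ 2 * n ^ 2)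
mainTheorem3 zero ()
mainTheorem3 (suc k) _ =
  (λ n _ G (degree≤Δ , _) α α-independenceNumber →
     independenceNumber-ratio-bound G degree≤Δ α-independenceNumber)
  , TightExample.tight k
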